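{- For every $r\in\mathbb N$ there is no $r$-round GLOCAL algorithm (on trees with degrees $\le 3$) that $3$-colors the collection $EI^{r+1}_3$.
   Context: Let $T_\Delta$ be the infinite $\Delta$-regular tree and $T^r_\Delta$ the ball of radius $r$ around a vertex of $T_\Delta$ (rooted at that vertex). A labeled tree is a tree together with a map from its vertices to a set of labels. An $r$-round GLOCAL algorithm (on trees with degrees $\le\Delta$) is a partial function $\mathcal A_r$ from isomorphism classes of labeled rooted trees of maximum degree $\le\Delta$ and radius $\le r$ (measured from the root) to a set $\Sigma$. Running $\mathcal A_r$ on a labeled tree $G$ of maximum degree $\le\Delta$ means assigning to each vertex $v$ the value of $\mathcal A_r$ on the labeled isomorphism class of the ball $B_G(v,r)$ rooted at $v$ (this gives a partial vertex labeling of $G$). For a collection $\mathcal F$ of finite labeled trees of degrees $\le\Delta$, $\mathcal A_r$ $k$-colors $\mathcal F$ if for every $G\in\mathcal F$, running $\mathcal A_r$ on $G$ assigns to every vertex one of $k$ colors and yields a proper vertex coloring of $G$. $EI^{r+1}_3$ denotes the set of labelings of $T^{r+1}_3$ with labels in $\{0,1,2,3\}$ such that adjacent vertices receive different labels. -}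

module Defs where

open import Data.Nat using (ℕ; zero; suc; _≤_; _≤ᵇ_)
open import Data.Fin using (Fin; _≟_)
open import Data.Bool using (Bool; true; false; not; _∧_)
open import Data.List using (List; []; _∷_; length; map; allFin; filterᵇ)
open import Data.List.Relation.Binary.Pointwise using (Pointwise)
open import Data.List.Relation.Binary.Permutation.Propositional using (_↭_)
open import Data.Maybe using (Maybe; just; nothing)
open import Data.Product using (Σ; ∃; _×_)
open import Data.Unit using (⊤)
open import Relation.Nullary using (¬_; does)
open import Relation.Binary.PropositionalEquality using (_≡_; _≢_)

Label : Set
Label = Fin 4

data RTree : Set where
  node : Label → List RTree → RTree

data _≅_ : RTree → RTree → Set where
  node : ∀ {l ts vs us} → ts ↭ vs → Pointwise _≅_ vs us → node l ts ≅ node l us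

-- An r-round GLOCAL algorithm with outputs in S: a partial function
-- (Maybe S) on labeled rooted trees that only depends on the
-- isomorphism class.  (Its values on trees of radius > r are never
-- used when running it with r rounds, see `output`.)

record GlocalAlg (S : Set) : Set where
  field
    run       : RTree → Maybe S
    invariant : ∀ {s t} → s ≅ t → run s ≡ run t
open GlocalAlg public

-- The 3-regular tree T_3 as the Cayley graph of Z2 * Z2 * Z2:
-- vertices are reduced words over Fin 3 (stored last-letter-first),
-- w is adjacent to  step b w  for each letter b.

Word : Set
Word = List (Fin 3)

Reduced : Word → Set
Reduced []            = ⊤
Reduced (a ∷ [])      = ⊤
Reduced (a ∷ b ∷ w)   = a ≢ b × Reduced (b ∷ w)

step : Fin 3 → Word → Word
step a []      = a ∷ []
step a (b ∷ w) with does (a ≟ b)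
... | true  = w
... | false = a ∷ b ∷ w

IsVertex : ℕ → Word → Set
IsVertex n w = Reduced w × length w ≤ n

-- The ball B_G(w, d) rooted at w, for G = T_3^n with labeling lab:
-- explore the tree from w without backtracking (excluded = letter
-- leading back to the parent), staying inside T_3^n, up to depth d.

excluded : Maybe (Fin 3) → Fin 3 → Bool
excluded nothing  b = false
excluded (just a) b = does (a ≟ b)

keep : ℕ → Maybe (Fin 3) → Word → Fin 3 → Bool
keep n ex w b = not (excluded ex b) ∧ (length (step b w) ≤ᵇ n)

ball : (n : ℕ) → (Word → Label) → (d : ℕ) → Maybe (Fin 3) → Word → RTree
ball n lab zero    ex w = node (lab w) []
ball n lab (suc d) ex w =
  node (lab w) (map (λ b → ball n lab d (just b) (step b w)) (filterᵇ (keep n ex w) (allFin 3)))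

-- EI^n_3 : proper labelings of T_3^n with labels in {0,1,2,3}.
-- (A labeling is given as a function on all words; only its values on
-- vertices of T_3^n matter.)

ProperLabeling : ℕ → (Word → Label) → Set
ProperLabeling n lab =
  ∀ w b → IsVertex n w → length (step b w) ≤ n → lab w ≢ lab (step b w)

output : ∀ {S} → GlocalAlg S → (r n : ℕ) → (Word → Label) → Word → Maybe S
output A r n lab w = run A (ball n lab r nothing w)

KColorsEI : ∀ {S} → (k : ℕ) → GlocalAlg S → (r n : ℕ) → Set
KColorsEI {S} k A r n =
  Σ (Fin k → S) λ col →
    ∀ lab → ProperLabeling n lab →
      (∀ w → IsVertex n w → ∃ λ i → output A r n lab w ≡ just (col i))
      × (∀ w b → IsVertex n w → length (step b w) ≤ n →
           output A r n lab w ≢ output A r n lab (step b w))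

{-# OPTIONS --safe #-}
-- Marks' determinacy argument.  For a colour i, a root label a and a label for the
-- root's neighbour along i, two players label T₃ layer by layer: player I the side of
-- the root, player II the side of the neighbour; I wins if the algorithm gives the root
-- colour i.  These finite games are determined (up to double negation, which suffices
-- for a contradiction).  If for some a player II wins the three games i = 0, 1, 2 (each
-- for some neighbour label), the three strategies can play against each other, I's moves
-- in each game being II's moves in the other two; this builds one proper labeling whose
-- root gets none of the three colours.  Otherwise every root label a has a colour i for
-- which I wins against every neighbour label; by pigeonhole two labels x ≠ y share a
-- colour i, and I's strategies for (x, neighbour y) and (y, neighbour x) played against
-- each other build a labeling in which both ends of an edge get colour i.
module Submission where

open import Data.Bool using (T; not; true; false; T?)
open import Data.Bool.Properties using (T-∧)
open import Data.Empty using (⊥; ⊥-elim)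
open import Data.Fin using (Fin; _≟_; punchIn; punchOut)
open import Data.Fin.Patterns using (0F; 1F; 2F)
open import Data.Fin.Properties using (punchInᵢ≢i; punchIn-punchOut; pigeonhole; <⇒≢)
open import Data.List using (List; []; _∷_; allFin; cartesianProduct; map; filterᵇ; length; head; reverse; _ʳ++_; _++_; _∷ʳ_)
open import Data.List.Membership.Propositional using (_∈_)
open import Data.List.Membership.Propositional.Properties using (∈-allFin; ∈-cartesianProduct⁺)
open import Data.List.Properties using (map-cong; map-cong-local; filter-≐; ʳ++-defn; reverse-++; reverse-involutive; unfold-reverse)
open import Data.List.Relation.Unary.All as All using (All; []; _∷_)
open import Data.List.Relation.Unary.All.Properties using (all-filter)
open import Data.List.Relation.Unary.Any as Any using ()
open import Data.Maybe using (Maybe; just; nothing)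
open import Data.Nat using (ℕ; zero; suc; _+_; _≤_; z≤n; s≤s)
open import Data.Nat.Properties using (≤-refl; ≤-trans; n<1+n; +-comm; +-suc; m≤n⇒m≤1+n; n≤1+n; +-monoˡ-≤; m+n≤o⇒m≤o; ≤⇒≤ᵇ)
open import Data.Product using (Σ; ∃; _×_; _,_; proj₁; proj₂)
open import Data.Sum using (_⊎_; inj₁; inj₂; swap)
open import Data.Unit using (⊤; tt)
open import Function using (_∘_)
open import Function.Bundles using (Equivalence)
open import Relation.Binary.PropositionalEquality using (_≡_; _≢_; refl; cong; cong₂; sym; trans; subst; ≢-sym; module ≡-Reasoning)
open import Relation.Nullary using (¬_; Dec; does; yes; no)
open import Relation.Nullary.Decidable using (dec-true; dec-false)
open import Relation.Nullary.Negation using (¬¬-map)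
open import Relation.Unary using (_≐_)

open import Defs

Enumeration : Set → Set
Enumeration X = Σ (List X) λ xs → ∀ x → x ∈ xs

Fin-enumeration : ∀ n → Enumeration (Fin n)
Fin-enumeration n = allFin n , ∈-allFin

×-enumeration : ∀ {X Y} → Enumeration X → Enumeration Y → Enumeration (X × Y)
×-enumeration (xs , x∈xs) (ys , y∈ys) =
  cartesianProduct xs ys , λ (x , y) → ∈-cartesianProduct⁺ (x∈xs x) (y∈ys y)

module _ {X : Set} (E : Enumeration X) where

  open Σ E renaming (proj₁ to xs; proj₂ to x∈xs)

  double-negation-shift : {B : X → Set} → (∀ x → ¬ ¬ B x) → ¬ ¬ (∀ x → B x)
  double-negation-shift {B} ¬¬B = ¬¬-map (λ Bs x → All.lookup Bs (x∈xs x)) (¬¬-All xs)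
    where
    ¬¬-All : ∀ ys → ¬ ¬ All B ys
    ¬¬-All []       ¬all = ¬all []
    ¬¬-All (y ∷ ys) ¬all = ¬¬B y λ By → ¬¬-All ys λ Bys → ¬all (By ∷ Bys)

  search : {C D : X → Set} → (∀ x → C x ⊎ D x) → ∃ C ⊎ (∀ x → D x)
  search C∪D with All.decide (swap ∘ C∪D) xs
  ... | inj₁ Ds = inj₂ (λ x → All.lookup Ds (x∈xs x))
  ... | inj₂ Cs = inj₁ (Any.satisfied Cs)

-- Finite games

module Game {Pos Move : ℕ → Set} (grow : ∀ {n} → Pos n → Move n → Pos (suc n)) where

  Payoff : Set₁
  Payoff = ∀ {n} → Pos n → Pos n → Set

  IWins : Payoff → ℕ → ∀ {n} → Pos n → Pos n → Set
  IWins W zero    P Q = W P Q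
  IWins W (suc m) P Q = ∃ λ x → ∀ y → IWins W m (grow P x) (grow Q y)

  IIWins : Payoff → ℕ → ∀ {n} → Pos n → Pos n → Set
  IIWins W zero    P Q = ¬ W P Q
  IIWins W (suc m) P Q = ∀ x → ∃ λ y → IIWins W m (grow P x) (grow Q y)

  determined : (∀ n → Enumeration (Move n)) → ∀ (W : Payoff) m {n} (P Q : Pos n) →
               ¬ ¬ (IWins W m P Q ⊎ IIWins W m P Q)
  determined E W zero    P Q ¬win = ¬win (inj₂ (¬win ∘ inj₁))
  determined E W (suc m) {n} P Q =
    ¬¬-map decide
      (double-negation-shift (E n) λ x → double-negation-shift (E n) λ y →
         determined E W m (grow P x) (grow Q y))
    where
    decide : (∀ x y → IWins W m (grow P x) (grow Q y) ⊎ IIWins W m (grow P x) (grow Q y)) →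
             IWins W (suc m) P Q ⊎ IIWins W (suc m) P Q
    decide d = search (E n) λ x → swap (search (E n) λ y → swap (d x y))

  first-players-meet : ∀ {W W' : Payoff} m {n} {P Q : Pos n} → IWins W m P Q → IWins W' m Q P →
                       ∃ λ k → Σ (Pos k) λ P' → Σ (Pos k) λ Q' → W P' Q' × W' Q' P'
  first-players-meet zero    w       w'        = _ , _ , _ , w , w'
  first-players-meet (suc m) (x , σ) (x' , σ') = first-players-meet m (σ x') (σ' x)

-- Balls of T₃ as trees of non-backtracking paths

walk : List (Fin 3) → Word → Word
walk []      w = w
walk (b ∷ p) w = walk p (step b w)

NonBacktracking : Maybe (Fin 3) → List (Fin 3) → Set
NonBacktracking ex []      = ⊤
NonBacktracking ex (b ∷ p) = T (not (excluded ex b)) × NonBacktracking (just b) p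

unroll : ℕ → Maybe (Fin 3) → (List (Fin 3) → Label) → RTree
unroll zero    ex f = node (f []) []
unroll (suc d) ex f =
  node (f []) (map (λ b → unroll d (just b) (f ∘ (b ∷_))) (filterᵇ (not ∘ excluded ex) (allFin 3)))

length-step : ∀ b w → length (step b w) ≤ suc (length w)
length-step b []      = ≤-refl
length-step b (c ∷ w) with does (b ≟ c)
... | true  = m≤n⇒m≤1+n (n≤1+n _)
... | false = ≤-refl

ball-unroll : ∀ {n} (L : Word → Label) d ex w → length w + d ≤ n →
              ball n L d ex w ≡ unroll d ex (λ p → L (walk p w))
ball-unroll L zero    ex w _ = refl
ball-unroll {n} L (suc d) ex w w+d≤n = cong (node (L w)) (begin
  map (λ b → ball n L d (just b) (step b w)) (filterᵇ (keep n ex w) (allFin 3))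
    ≡⟨ cong (map _) (filter-≐ (T? ∘ keep n ex w) (T? ∘ not ∘ excluded ex) kept-≐ (allFin 3)) ⟩
  map (λ b → ball n L d (just b) (step b w)) (filterᵇ (not ∘ excluded ex) (allFin 3))
    ≡⟨ map-cong (λ b → ball-unroll L d (just b) (step b w) (child-bound b)) _ ⟩
  map (λ b → unroll d (just b) (λ p → L (walk (b ∷ p) w))) (filterᵇ (not ∘ excluded ex) (allFin 3)) ∎)
  where
  open ≡-Reasoning
  child-bound : ∀ b → length (step b w) + d ≤ n
  child-bound b = ≤-trans (+-monoˡ-≤ d (length-step b w)) (subst (_≤ n) (+-suc (length w) d) w+d≤n)
  kept-≐ : (T ∘ keep n ex w) ≐ (T ∘ not ∘ excluded ex)
  kept-≐ = proj₁ ∘ Equivalence.to T-∧ ,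
           λ {b} t → Equivalence.from T-∧ (t , ≤⇒≤ᵇ (m+n≤o⇒m≤o (length (step b w)) (child-bound b)))

unroll-cong : ∀ d ex {f g} → (∀ p → NonBacktracking ex p → length p ≤ d → f p ≡ g p) →
              unroll d ex f ≡ unroll d ex g
unroll-cong zero    ex f≈g = cong (λ l → node l []) (f≈g [] tt z≤n)
unroll-cong (suc d) ex f≈g =
  cong₂ node (f≈g [] tt z≤n)
    (map-cong-local (All.map (λ {b} b-ok → unroll-cong d (just b) λ p p-ok p≤d →
                                f≈g (b ∷ p) (b-ok , p-ok) (s≤s p≤d))
                             (all-filter (T? ∘ not ∘ excluded ex) (allFin 3))))

excluded-≢ : ∀ {a b} → T (not (excluded (just a) b)) → a ≢ b
excluded-≢ {a} {b} t a≡b rewrite dec-true (a ≟ b) a≡b = t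

≢-excluded : ∀ {a b} → a ≢ b → T (not (excluded (just a) b))
≢-excluded {a} {b} a≢b rewrite dec-false (a ≟ b) a≢b = tt

NonBacktracking-nothing : ∀ ex p → NonBacktracking ex p → NonBacktracking nothing p
NonBacktracking-nothing ex []      _          = tt
NonBacktracking-nothing ex (b ∷ p) (_ , p-ok) = tt , p-ok

step-back : ∀ b w → step b (b ∷ w) ≡ w
step-back b w rewrite dec-true (b ≟ b) refl = refl

step-forward : ∀ b w → T (not (excluded (head w) b)) → step b w ≡ b ∷ w
step-forward b []      _ = refl
step-forward b (c ∷ w) t rewrite dec-false (b ≟ c) (≢-sym (excluded-≢ t)) = refl

walk-forward : ∀ p w → NonBacktracking (head w) p → walk p w ≡ p ʳ++ w
walk-forward []      w _          = refl
walk-forward (b ∷ p) w (t , p-ok) rewrite step-forward b w t = walk-forward p (b ∷ w) p-ok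

reverse-ʳ++ : ∀ {A : Set} (xs ys : List A) → reverse (xs ʳ++ ys) ≡ ys ʳ++ xs
reverse-ʳ++ xs ys = begin
  reverse (xs ʳ++ ys)                ≡⟨ cong reverse (ʳ++-defn xs) ⟩
  reverse (reverse xs ++ ys)         ≡⟨ reverse-++ (reverse xs) ys ⟩
  reverse ys ++ reverse (reverse xs) ≡⟨ cong (reverse ys ++_) (reverse-involutive xs) ⟩
  reverse ys ++ xs                   ≡⟨ ʳ++-defn ys ⟨
  ys ʳ++ xs                          ∎
  where open ≡-Reasoning

-- Words list their letters from the vertex back to the root, paths from the root outwards.
onWords : (List (Fin 3) → Label) → Word → Label
onWords f w = f (reverse w)

onWords-walk : ∀ f p w → NonBacktracking (head w) p → onWords f (walk p w) ≡ f (w ʳ++ p)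
onWords-walk f p w p-ok = cong f (trans (cong reverse (walk-forward p w p-ok)) (reverse-ʳ++ p w))

ball-root : ∀ {n} f r → r ≤ n → ball n (onWords f) r nothing [] ≡ unroll r nothing f
ball-root f r r≤n =
  trans (ball-unroll (onWords f) r nothing [] r≤n)
        (unroll-cong r nothing λ p p-ok _ → onWords-walk f p [] p-ok)

-- Proper labelings from choices

-- Each vertex chooses which of the three labels other than its parent's it gets.
pathLabel : Label → (List (Fin 3) → Fin 3) → List (Fin 3) → Label
pathLabel a h []      = a
pathLabel a h (c ∷ p) = pathLabel (punchIn a (h (c ∷ []))) (h ∘ (c ∷_)) p

pathLabel-cong : ∀ d {a h g} → (∀ q → length q ≤ d → h q ≡ g q) →
                 ∀ p → length p ≤ d → pathLabel a h p ≡ pathLabel a g p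
pathLabel-cong d       h≈g []      _         = refl
pathLabel-cong (suc d) {a} {h} h≈g (c ∷ p) (s≤s p≤d) =
  trans (cong (λ x → pathLabel (punchIn a x) (h ∘ (c ∷_)) p) (h≈g (c ∷ []) (s≤s z≤n)))
        (pathLabel-cong d (λ q q≤d → h≈g (c ∷ q) (s≤s q≤d)) p p≤d)

pathLabel-∷-cong : ∀ {a h g} c p → (∀ q → h (c ∷ q) ≡ g (c ∷ q)) →
                   pathLabel a h (c ∷ p) ≡ pathLabel a g (c ∷ p)
pathLabel-∷-cong {a} {h} c p h≈g =
  trans (cong (λ x → pathLabel (punchIn a x) (h ∘ (c ∷_)) p) (h≈g []))
        (pathLabel-cong (length p) (λ q _ → h≈g q) p ≤-refl)

pathLabel-∷ʳ : ∀ a h p b → pathLabel a h (p ∷ʳ b) ≡ punchIn (pathLabel a h p) (h (p ∷ʳ b))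
pathLabel-∷ʳ a h []      b = refl
pathLabel-∷ʳ a h (c ∷ p) b = pathLabel-∷ʳ (punchIn a (h (c ∷ []))) (h ∘ (c ∷_)) p b

onWords-pathLabel-∷-≢ : ∀ a h b w → onWords (pathLabel a h) (b ∷ w) ≢ onWords (pathLabel a h) w
onWords-pathLabel-∷-≢ a h b w eq = punchInᵢ≢i (pathLabel a h (reverse w)) _ (begin
  punchIn (pathLabel a h (reverse w)) _ ≡⟨ pathLabel-∷ʳ a h (reverse w) b ⟨
  pathLabel a h (reverse w ∷ʳ b)       ≡⟨ cong (pathLabel a h) (unfold-reverse b w) ⟨
  pathLabel a h (reverse (b ∷ w))      ≡⟨ eq ⟩
  pathLabel a h (reverse w)            ∎)
  where open ≡-Reasoning

pathLabel-proper : ∀ n a h → ProperLabeling n (onWords (pathLabel a h))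
pathLabel-proper n a h w b _ _ = proper w b
  where
  proper : ∀ w b → onWords (pathLabel a h) w ≢ onWords (pathLabel a h) (step b w)
  proper []      b = onWords-pathLabel-∷-≢ a h b [] ∘ sym
  proper (c ∷ w) b with b ≟ c
  ... | yes refl = onWords-pathLabel-∷-≢ a h b w
  ... | no _     = onWords-pathLabel-∷-≢ a h b (c ∷ w) ∘ sym

-- Positions of the edge games

Layer : ℕ → Set
Layer zero    = Fin 3
Layer (suc k) = Layer k × Layer k

Layer-enumeration : ∀ k → Enumeration (Layer k)
Layer-enumeration zero    = Fin-enumeration 3
Layer-enumeration (suc k) = ×-enumeration (Layer-enumeration k) (Layer-enumeration k)

-- Choices of a vertex and of its descendants up to distance n.
mutual
  Tree : ℕ → Set
  Tree n = Fin 3 × Forest n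

  Forest : ℕ → Set
  Forest zero    = ⊤
  Forest (suc n) = Tree n × Tree n

mutual
  growT : ∀ {n} → Tree n → Layer (suc n) → Tree (suc n)
  growT (m , F) ℓ = m , growF F ℓ

  growF : ∀ {n} → Forest n → Layer (suc n) → Forest (suc n)
  growF {zero}  tt      (l , l') = (l , tt) , (l' , tt)
  growF {suc n} (s , t) (ℓ , ℓ') = growT s ℓ , growT t ℓ'

-- The children of a vertex entered along x are the two other letters, in increasing
-- order; branch x x is junk, as non-backtracking paths never turn back.
others : {X : Set} → Fin 3 → (Fin 3 → X) → X × X
others 0F f = f 1F , f 2F
others 1F f = f 0F , f 2F
others 2F f = f 0F , f 1F

branch : {X : Set} → Fin 3 → Fin 3 → X × X → X
branch 0F 2F = proj₂
branch 1F 2F = proj₂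
branch 2F 1F = proj₂
branch _  _  = proj₁

mutual
  readTree : ∀ {n} → Fin 3 → Tree n → List (Fin 3) → Fin 3
  readTree x (m , F) []      = m
  readTree x (m , F) (c ∷ p) = readForest x F c p

  readForest : ∀ {n} → Fin 3 → Forest n → Fin 3 → List (Fin 3) → Fin 3
  readForest {zero}  x tt      c p = 0F
  readForest {suc n} x (s , t) c p = branch x c (readTree c s p , readTree c t p)

readTree-grow : ∀ {n} x (T : Tree n) ℓ p → length p ≤ n → readTree x (growT T ℓ) p ≡ readTree x T p
readTree-grow x T ℓ [] _ = refl
readTree-grow {suc n} x (m , s , t) (ℓ , ℓ') (c ∷ p) (s≤s p≤n) =
  cong (branch x c) (cong₂ _,_ (readTree-grow c s ℓ p p≤n) (readTree-grow c t ℓ' p p≤n))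

readForest-others : ∀ {n} x c (T : Fin 3 → Tree n) p → c ≢ x →
                    readForest x (others x T) c p ≡ readTree c (T c) p
readForest-others 0F 0F T p c≢x = ⊥-elim (c≢x refl)
readForest-others 0F 1F T p _   = refl
readForest-others 0F 2F T p _   = refl
readForest-others 1F 0F T p _   = refl
readForest-others 1F 1F T p c≢x = ⊥-elim (c≢x refl)
readForest-others 1F 2F T p _   = refl
readForest-others 2F 0F T p _   = refl
readForest-others 2F 1F T p _   = refl
readForest-others 2F 2F T p c≢x = ⊥-elim (c≢x refl)

growF-others : ∀ {n} x (T : Fin 3 → Tree n) (ℓ : Fin 3 → Layer (suc n)) →
               growF (others x T) (others x ℓ) ≡ others x (λ c → growT (T c) (ℓ c))
growF-others 0F T ℓ = refl
growF-others 1F T ℓ = refl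
growF-others 2F T ℓ = refl

growF-tt-others : ∀ x (m : Fin 3 → Fin 3) → growF tt (others x m) ≡ others x (λ c → m c , tt)
growF-tt-others 0F m = refl
growF-tt-others 1F m = refl
growF-tt-others 2F m = refl

-- The root's neighbour along i has choice mb; P holds the other two subtrees of the root
-- and Q the two subtrees of that neighbour.  The root's own choice is never read.
edgeChoices : ∀ {n} → Fin 3 → Fin 3 → Forest n → Forest n → List (Fin 3) → Fin 3
edgeChoices i mb P Q []      = 0F
edgeChoices i mb P Q (c ∷ p) with c ≟ i
... | yes _ = readTree i (mb , Q) p
... | no _  = readForest i P c p

edgeChoices-here : ∀ {n} i mb (P Q : Forest n) p → edgeChoices i mb P Q (i ∷ p) ≡ readTree i (mb , Q) p
edgeChoices-here i mb P Q p with i ≟ i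
... | yes _  = refl
... | no i≢i = ⊥-elim (i≢i refl)

edgeChoices-there : ∀ {n} i mb (P Q : Forest n) c p → c ≢ i →
                    edgeChoices i mb P Q (c ∷ p) ≡ readForest i P c p
edgeChoices-there i mb P Q c p c≢i with c ≟ i
... | yes c≡i = ⊥-elim (c≢i c≡i)
... | no _    = refl

edgeChoices-flip : ∀ {n} i mb ma (P Q : Forest n) c p → c ≢ i →
                   edgeChoices i mb P Q (c ∷ p) ≡ edgeChoices i ma Q P (i ∷ c ∷ p)
edgeChoices-flip i mb ma P Q c p c≢i =
  trans (edgeChoices-there i mb P Q c p c≢i) (sym (edgeChoices-here i ma Q P (c ∷ p)))

-- Seen from the neighbour along i, the edge configuration is the one with the roles of
-- the two sides exchanged.
edge-flip : ∀ {n} i {a b mb ma} (P Q : Forest n) → punchIn a mb ≡ b → punchIn b ma ≡ a →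
            ∀ p → NonBacktracking nothing p →
            onWords (pathLabel a (edgeChoices i mb P Q)) (walk p (i ∷ [])) ≡
            pathLabel b (edgeChoices i ma Q P) p
edge-flip i {a} {b} {mb} {ma} P Q a→b b→a = flip
  where
  open ≡-Reasoning
  h₁ h₂ : List (Fin 3) → Fin 3
  h₁ = edgeChoices i mb P Q
  h₂ = edgeChoices i ma Q P

  a→b' : punchIn a (h₁ (i ∷ [])) ≡ b
  a→b' = trans (cong (punchIn a) (edgeChoices-here i mb P Q [])) a→b

  b→a' : punchIn b (h₂ (i ∷ [])) ≡ a
  b→a' = trans (cong (punchIn b) (edgeChoices-here i ma Q P [])) b→a

  behind : ∀ p → NonBacktracking (just i) p → pathLabel a h₁ p ≡ pathLabel a (h₂ ∘ (i ∷_)) p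
  behind []      _       = refl
  behind (c ∷ p) (t , _) = pathLabel-∷-cong {h = h₁} {g = h₂ ∘ (i ∷_)} c p λ q →
    edgeChoices-flip i mb ma P Q c q (≢-sym (excluded-≢ t))

  flip-∷ : ∀ c p → NonBacktracking (just c) p → Dec (c ≡ i) →
           onWords (pathLabel a h₁) (walk (c ∷ p) (i ∷ [])) ≡ pathLabel b h₂ (c ∷ p)
  flip-∷ c p p-ok (yes refl) = begin
    onWords (pathLabel a h₁) (walk p (step i (i ∷ [])))
      ≡⟨ cong (onWords (pathLabel a h₁) ∘ walk p) (step-back i []) ⟩
    onWords (pathLabel a h₁) (walk p [])
      ≡⟨ onWords-walk (pathLabel a h₁) p [] (NonBacktracking-nothing (just i) p p-ok) ⟩
    pathLabel a h₁ p
      ≡⟨ behind p p-ok ⟩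
    pathLabel a (h₂ ∘ (i ∷_)) p
      ≡⟨ cong (λ x → pathLabel x (h₂ ∘ (i ∷_)) p) b→a' ⟨
    pathLabel b h₂ (i ∷ p)
      ∎
  flip-∷ c p p-ok (no c≢i) = begin
    onWords (pathLabel a h₁) (walk (c ∷ p) (i ∷ []))
      ≡⟨ onWords-walk (pathLabel a h₁) (c ∷ p) (i ∷ []) (≢-excluded (≢-sym c≢i) , p-ok) ⟩
    pathLabel a h₁ (i ∷ c ∷ p)
      ≡⟨ cong (λ x → pathLabel x (h₁ ∘ (i ∷_)) (c ∷ p)) a→b' ⟩
    pathLabel b (h₁ ∘ (i ∷_)) (c ∷ p)
      ≡⟨ pathLabel-∷-cong {h = h₁ ∘ (i ∷_)} {g = h₂} c p
           (λ q → sym (edgeChoices-flip i ma mb Q P c q c≢i)) ⟩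
    pathLabel b h₂ (c ∷ p)
      ∎

  flip : ∀ p → NonBacktracking nothing p → onWords (pathLabel a h₁) (walk p (i ∷ [])) ≡ pathLabel b h₂ p
  flip []      _          = a→b'
  flip (c ∷ p) (_ , p-ok) = flip-∷ c p p-ok (c ≟ i)

starChoices : ∀ {n} → (Fin 3 → Tree n) → List (Fin 3) → Fin 3
starChoices T []      = 0F
starChoices T (c ∷ p) = readTree c (T c) p

starChoices-edge : ∀ {n} j (T : Fin 3 → Tree n) ℓ p → length p ≤ suc n →
                   starChoices T p ≡ edgeChoices j (proj₁ (T j)) (others j T) (proj₂ (growT (T j) ℓ)) p
starChoices-edge j T ℓ []      _         = refl
starChoices-edge j T ℓ (c ∷ p) (s≤s p≤n) with c ≟ j
... | yes refl = sym (readTree-grow c (T c) ℓ p p≤n)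
... | no c≢j   = sym (readForest-others j c T p c≢j)

-- Marks' argument

module Marks {S : Set} (A : GlocalAlg S) (r : ℕ) (K : KColorsEI 3 A r (suc r)) where

  open Σ K renaming (proj₁ to col; proj₂ to colours)
  open Game {Forest} {Layer ∘ suc} growF

  RootColoured : Fin 3 → Label → Fin 3 → Payoff
  RootColoured i a mb P Q = run A (unroll r nothing (pathLabel a (edgeChoices i mb P Q))) ≡ just (col i)

  root-coloured : ∀ a h → ∃ λ k → run A (unroll r nothing (pathLabel a h)) ≡ just (col k)
  root-coloured a h with proj₁ (colours _ (pathLabel-proper (suc r) a h)) [] (tt , z≤n)
  ... | k , coloured = k , trans (cong (run A) (sym (ball-root (pathLabel a h) r (n≤1+n r)))) coloured

  module _ (a : Label) where

    -- In game j, I's move is the pair of II's last moves in the other two games, so I's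
    -- side of game j is made of II's sides of the other games (one layer behind).
    II-strategies-absurd :
      ∀ m {n} → m + suc n ≡ r → (T : Fin 3 → Tree n) (ℓ : Fin 3 → Layer (suc n)) →
      (∀ j → IIWins (RootColoured j a (proj₁ (T j))) m (others j T) (proj₂ (growT (T j) (ℓ j)))) → ⊥
    II-strategies-absurd zero refl T ℓ ¬won with root-coloured a (starChoices T)
    ... | k , coloured = ¬won k (trans (cong (run A) (unroll-cong r nothing λ p _ p≤r →
            pathLabel-cong r {a} (λ q q≤r → sym (starChoices-edge k T (ℓ k) q q≤r)) p p≤r)) coloured)
    II-strategies-absurd (suc m) {n} m+n≡r T ℓ σ =
      II-strategies-absurd m (trans (+-suc m (suc n)) m+n≡r) T′ ℓ′ σ′
      where
      T′ : Fin 3 → Tree (suc n)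
      T′ c = growT (T c) (ℓ c)
      ℓ′ : Fin 3 → Layer (suc (suc n))
      ℓ′ j = proj₁ (σ j (others j ℓ))
      σ′ : ∀ j → IIWins (RootColoured j a (proj₁ (T j))) m (others j T′) (proj₂ (growT (T′ j) (ℓ′ j)))
      σ′ j = subst (λ P → IIWins (RootColoured j a (proj₁ (T j))) m P (proj₂ (growT (T′ j) (ℓ′ j))))
                   (growF-others j T ℓ) (proj₂ (σ j (others j ℓ)))

    IIWins-all-colours-absurd :
      ∀ m → m ≡ r → (mb : Fin 3 → Fin 3) → (∀ j → IIWins (RootColoured j a (mb j)) m tt tt) → ⊥
    IIWins-all-colours-absurd zero refl mb σ =
      -- at radius 0 the algorithm sees only the root label a
      let k , coloured = root-coloured a (λ _ → 0F) in σ k coloured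
    IIWins-all-colours-absurd (suc m) m≡r mb σ =
      II-strategies-absurd m (trans (+-comm m 1) m≡r) (λ c → mb c , tt) ℓ σ′
      where
      ℓ : Fin 3 → Layer 1
      ℓ j = proj₁ (σ j (others j mb))
      σ′ : ∀ j → IIWins (RootColoured j a (mb j)) m (others j (λ c → mb c , tt)) (growF tt (ℓ j))
      σ′ j = subst (λ P → IIWins (RootColoured j a (mb j)) m P (growF tt (ℓ j)))
                   (growF-tt-others j mb) (proj₂ (σ j (others j mb)))

  monochromatic-edge-absurd : ∀ i {a b mb ma n} (P Q : Forest n) → punchIn a mb ≡ b → punchIn b ma ≡ a →
                              RootColoured i a mb P Q → RootColoured i b ma Q P → ⊥
  monochromatic-edge-absurd i {a} {b} {mb} P Q a→b b→a at-a at-b =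
    proj₂ (colours L (pathLabel-proper (suc r) a h)) [] i (tt , z≤n) (s≤s z≤n) (trans at-root (sym at-child))
    where
    h : List (Fin 3) → Fin 3
    h = edgeChoices i mb P Q
    L : Word → Label
    L = onWords (pathLabel a h)
    at-root : output A r (suc r) L [] ≡ just (col i)
    at-root = trans (cong (run A) (ball-root (pathLabel a h) r (n≤1+n r))) at-a
    at-child : output A r (suc r) L (i ∷ []) ≡ just (col i)
    at-child = trans (cong (run A) (trans (ball-unroll L r nothing (i ∷ []) ≤-refl)
                       (unroll-cong r nothing λ p p-ok _ → edge-flip i P Q a→b b→a p p-ok))) at-b

  Decided : Set
  Decided = ∀ i a mb → IWins (RootColoured i a mb) r tt tt ⊎ IIWins (RootColoured i a mb) r tt tt

  I-winning-colour : Decided → ∀ a → ∃ λ i → ∀ mb → IWins (RootColoured i a mb) r tt tt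
  I-winning-colour decided a
    with search (Fin-enumeration 3) (λ i → swap (search (Fin-enumeration 3) (swap ∘ decided i a)))
  ... | inj₁ found = found
  ... | inj₂ σ     = ⊥-elim (IIWins-all-colours-absurd a r refl (proj₁ ∘ σ) (proj₂ ∘ σ))

  shared-I-winning-colour-absurd : (decided : Decided) {x y : Label} → x ≢ y →
    proj₁ (I-winning-colour decided x) ≡ proj₁ (I-winning-colour decided y) → ⊥
  shared-I-winning-colour-absurd decided {x} {y} x≢y same
    with first-players-meet r (proj₂ (I-winning-colour decided x) (punchOut x≢y))
           (subst (λ i → ∀ mb → IWins (RootColoured i y mb) r tt tt) (sym same)
                  (proj₂ (I-winning-colour decided y)) (punchOut (≢-sym x≢y)))
  ... | _ , P , Q , at-x , at-y =
    monochromatic-edge-absurd _ P Q (punchIn-punchOut x≢y) (punchIn-punchOut (≢-sym x≢y)) at-x at-y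

  decided-absurd : Decided → ⊥
  decided-absurd decided with pigeonhole (n<1+n 3) (proj₁ ∘ I-winning-colour decided)
  ... | x , y , x<y , same = shared-I-winning-colour-absurd decided (<⇒≢ x<y) same

  absurd : ⊥
  absurd =
    double-negation-shift (Fin-enumeration 3) (λ i →
    double-negation-shift (Fin-enumeration 4) λ a →
    double-negation-shift (Fin-enumeration 3) λ mb →
    determined (Layer-enumeration ∘ suc) (RootColoured i a mb) r tt tt) decided-absurd

mainTheorem2 : (r : ℕ) (S : Set) (A : GlocalAlg S) → ¬ KColorsEI 3 A r (suc r)
mainTheorem2 r S A = Marks.absurd A r
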